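{- Let $\varphi=\langle X,Q,D,C\rangle$ be a QCSP in which value $a\in D_{x_i}$ is dual-shallow-fixable for a universal variable $x_i$, and let $\varphi'=\langle X,Q,D',C\rangle$ where $D'_{x_i}=\{a\}$ and $D'_{x_j}=D_{x_j}$ for all $j\ne i$. Then $\varphi$ is true iff $\varphi'$ is true.
   Context: Fix a finite set $\mathbb{D}$. For a finite set $V$ of variables, a $V$-tuple is a map $t:V\to\mathbb{D}$ (value at $x$ written $t_x$), and a $V$-relation is a set of $V$-tuples. A QCSP is a tuple $\varphi=\langle X,Q,D,C\rangle$ where $X=\{x_1,\dots,x_n\}$ is a finite set of variables linearly ordered by index, $Q$ assigns to each $x_i$ a quantifier $Q_{x_i}\in\{\forall,\exists\}$, $D$ assigns to each $x_i$ a domain $D_{x_i}\subseteq\mathbb{D}$, and $C$ is a finite set of constraints, each a $V$-relation for some $V\subseteq X$. For a $V$-tuple $t$ and $U\subseteq V$, $t|_U$ is its restriction. An $X$-tuple $t$ satisfies $C$ if $t|_V\in c$ for every $V$-relation $c\in C$; $\mathsf{sol}$ is the set of such tuples. $\prod_{y\in V}D_y$ is the set of $V$-tuples $t$ with $t_y\in D_y$ for all $y$. Let $X_j=\{x_i:i\le j\}$, $E=\{x_i:Q_{x_i}=\exists\}$, $A=\{x_i:Q_{x_i}=\forall\}$ (universal variables), $A_j=A\cap X_j$. A strategy is a family $s=(s_{x_i})_{x_i\in E}$ of functions $s_{x_i}:\prod_{y\in A_{i-1}}D_y\to D_{x_i}$; its scenarios $\mathsf{sce}(s)$ are the $t\in\prod_{x\in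 X}D_x$ with $t_{x_i}=s_{x_i}(t|_{A_{i-1}})$ for all $x_i\in E$; $s$ is winning if $\mathsf{sce}(s)\subseteq\mathsf{sol}$; the outcomes are $\mathsf{out}=\bigcup_{s\text{ winning}}\mathsf{sce}(s)$. Value $a$ is shallow-fixable for $x_i$ (in a given QCSP) if $\forall t\in\mathsf{out}.\ \exists t'\in\mathsf{out}.\ (t|_{X_{i-1}}=t'|_{X_{i-1}}\wedge t'_{x_i}=a)$. The QCSP $\varphi$ is true if the sentence $Q_{x_1}x_1\in D_{x_1}\cdots Q_{x_n}x_n\in D_{x_n}.\ \bigwedge_{c\in C}c(\vec y_c)$ holds over $\mathbb{D}$ (quantifiers bounded to the domains, constraint symbols interpreted by their relations). The negation $\neg\varphi$ of $\varphi$ is the QCSP representing the negation of this sentence, i.e. with the same variables, order and domains, every quantifier replaced by its dual, and the conjunction of constraints replaced by its complement (the set of tuples in $\prod_{x\in X}D_x$ not satisfying $C$); $\neg\varphi$ is true iff $\varphi$ is false. Value $a$ is dual-shallow-fixable for $x_i$ in $\varphi$ if it is shallow-fixable for $x_i$ in $\neg\varphi$. -}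

module Defs where

open import Data.Nat using (ℕ; zero; suc)
open import Data.Fin using (Fin; zero; suc; _<_)
open import Data.Fin.Properties using (_≟_; _<?_)
open import Data.Fin.Subset using (Subset; ⊤; ⁅_⁆)
open import Data.Bool using (Bool; true; false; _∧_; not; if_then_else_; T)
open import Data.Unit using (tt)
open import Data.Vec using (Vec; []; _∷_; lookup; tabulate)
open import Data.List using (List; []; _∷_)
open import Data.Product using (Σ; _×_; _,_; proj₁; proj₂; ∃)
open import Relation.Nullary.Decidable using (⌊_⌋)
open import Relation.Binary.PropositionalEquality using (_≡_)

-- The fixed finite set 𝔻 is modelled as Fin d.
-- Variables x_1 … x_n are modelled as Fin n (0-based, order = index order).
-- An X-tuple is a Vec (Fin d) n.
-- A subset V ⊆ X is a Subset n; a V-tuple is the vector of the values of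
-- the members of V, listed in increasing index order.

size : ∀ {n} → Subset n → ℕ
size [] = zero
size (true ∷ V) = suc (size V)
size (false ∷ V) = size V

VTuple : ∀ {n} → ℕ → Subset n → Set
VTuple d V = Vec (Fin d) (size V)

restrict : ∀ {n d} (V : Subset n) → Vec (Fin d) n → VTuple d V
restrict [] [] = []
restrict (true ∷ V) (x ∷ t) = x ∷ restrict V t
restrict (false ∷ V) (x ∷ t) = restrict V t

Relation : ∀ {n} → ℕ → Subset n → Set
Relation d V = VTuple d V → Bool

Constraint : ℕ → ℕ → Set
Constraint n d = Σ (Subset n) (Relation d)

data Quant : Set where
  ∀q ∃q : Quant

dual : Quant → Quant
dual ∀q = ∃q
dual ∃q = ∀q

isForall : Quant → Bool
isForall ∀q = true
isForall ∃q = false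

record QCSP (n d : ℕ) : Set where
  field
    Q : Fin n → Quant
    D : Fin n → Subset d
    C : List (Constraint n d)

open QCSP public

satB : ∀ {n d} → List (Constraint n d) → Vec (Fin d) n → Bool
satB [] t = true
satB ((V , c) ∷ cs) t = c (restrict V t) ∧ satB cs t

Sol : ∀ {n d} → QCSP n d → Vec (Fin d) n → Set
Sol φ t = T (satB (C φ) t)

inDomV : ∀ {n d} (V : Subset n) (D : Fin n → Subset d) → VTuple d V → Bool
inDomV [] D u = true
inDomV (true ∷ V) D (v ∷ u) = lookup (D zero) v ∧ inDomV V (λ j → D (suc j)) u
inDomV (false ∷ V) D u = inDomV V (λ j → D (suc j)) u

inDom : ∀ {n d} (D : Fin n → Subset d) → Vec (Fin d) n → Bool
inDom D [] = true
inDom D (v ∷ t) = lookup (D zero) v ∧ inDom (λ j → D (suc j)) t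

private
  ∧-split : ∀ {a b} → T (a ∧ b) → T a × T b
  ∧-split {true} {true} _ = tt , tt

  ∧-join : ∀ {a b} → T a → T b → T (a ∧ b)
  ∧-join {true} {true} _ _ = tt

restrict-inDom : ∀ {n d} (V : Subset n) (D : Fin n → Subset d) (t : Vec (Fin d) n) →
                 T (inDom D t) → T (inDomV V D (restrict V t))
restrict-inDom [] D [] p = tt
restrict-inDom (true ∷ V) D (x ∷ t) p =
  ∧-join (proj₁ (∧-split p)) (restrict-inDom V (λ j → D (suc j)) t (proj₂ (∧-split p)))
restrict-inDom (false ∷ V) D (x ∷ t) p =
  restrict-inDom V (λ j → D (suc j)) t (proj₂ (∧-split {lookup (D zero) x} p))

-- A_{i-1}: universal variables strictly before x_i
Abefore : ∀ {n} → (Fin n → Quant) → Fin n → Subset n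
Abefore Q i = tabulate (λ j → ⌊ j <? i ⌋ ∧ isForall (Q j))

Strategy : ∀ {n d} → QCSP n d → Set
Strategy {n} {d} φ = (i : Fin n) → Q φ i ≡ ∃q →
  (u : VTuple d (Abefore (Q φ) i)) → T (inDomV (Abefore (Q φ) i) (D φ) u) →
  Σ (Fin d) (λ v → T (lookup (D φ i) v))

Sce : ∀ {n d} (φ : QCSP n d) → Strategy φ → Vec (Fin d) n → Set
Sce {n} φ s t = Σ (T (inDom (D φ) t)) λ p →
  (i : Fin n) (e : Q φ i ≡ ∃q) →
  lookup t i ≡ proj₁ (s i e (restrict (Abefore (Q φ) i) t)
                             (restrict-inDom (Abefore (Q φ) i) (D φ) t p))

Winning : ∀ {n d} (φ : QCSP n d) → Strategy φ → Set
Winning {n} {d} φ s = (t : Vec (Fin d) n) → Sce φ s t → Sol φ t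

Out : ∀ {n d} (φ : QCSP n d) → Vec (Fin d) n → Set
Out φ t = Σ (Strategy φ) λ s → Winning φ s × Sce φ s t

ShallowFixable : ∀ {n d} (φ : QCSP n d) → Fin n → Fin d → Set
ShallowFixable {n} {d} φ i a = (t : Vec (Fin d) n) → Out φ t →
  Σ (Vec (Fin d) n) λ t' → Out φ t' ×
    (((j : Fin n) → j < i → lookup t j ≡ lookup t' j) × lookup t' i ≡ a)

quant : ∀ {d} → Quant → Subset d → (Fin d → Set) → Set
quant {d} ∀q Dx P = (v : Fin d) → T (lookup Dx v) → P v
quant {d} ∃q Dx P = Σ (Fin d) λ v → T (lookup Dx v) × P v

eval : ∀ {d} m → (Fin m → Quant) → (Fin m → Subset d) → (Vec (Fin d) m → Set) → Set
eval zero Q D P = P []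
eval (suc m) Q D P =
  quant (Q zero) (D zero) λ v → eval m (λ j → Q (suc j)) (λ j → D (suc j)) (λ t → P (v ∷ t))

IsTrue : ∀ {n d} → QCSP n d → Set
IsTrue {n} φ = eval n (Q φ) (D φ) (Sol φ)

fullToVec : ∀ {d} n → VTuple d (⊤ {n}) → Vec (Fin d) n
fullToVec zero [] = []
fullToVec (suc n) (v ∷ u) = v ∷ fullToVec n u

complementRel : ∀ {n d} → QCSP n d → Relation d (⊤ {n})
complementRel {n} φ u = inDom (D φ) (fullToVec n u) ∧ not (satB (C φ) (fullToVec n u))

negQCSP : ∀ {n d} → QCSP n d → QCSP n d
negQCSP φ = record
  { Q = λ j → dual (Q φ j)
  ; D = D φ
  ; C = (⊤ , complementRel φ) ∷ []
  }

DualShallowFixable : ∀ {n d} (φ : QCSP n d) → Fin n → Fin d → Set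
DualShallowFixable φ i a = ShallowFixable (negQCSP φ) i a

fixDomain : ∀ {n d} → QCSP n d → Fin n → Fin d → QCSP n d
fixDomain φ i a = record
  { Q = Q φ
  ; D = λ j → if ⌊ j ≟ i ⌋ then ⁅ a ⁆ else D φ j
  ; C = C φ
  }

module Submission where

-- Let φ' be φ with the domain of the universal x_i shrunk to {a}.  φ ⇒ φ'
-- since shrinking a universal domain only makes a sentence easier.  If φ'
-- holds but φ fails, then over finite domains ¬φ (the dual game ψ) is true.
-- Induction along the prefix shows ψ and φ' cannot both be true: before x_i
-- we follow a common first value and fixability passes to the subgame; at
-- x_i fixability yields an outcome of ψ playing a, so ψ with x_i = a is
-- true, contradicting φ' with x_i = a.

open import Defs
open import Data.Nat using (ℕ; zero; suc; z≤n; s≤s)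
open import Data.Fin using (Fin; zero; suc; _<_)
open import Data.Fin.Properties using (_≟_; _<?_; all?; any?; ¬∀⟶∃¬; suc-injective)
open import Data.Fin.Subset using (Subset; ⊤; _∈_)
open import Data.Fin.Subset.Properties using (x∈⁅x⁆; x∈⁅y⁆⇒x≡y)
open import Data.Bool using (Bool; true; false; _∧_; not; T)
open import Data.Bool.Properties using (T-∧; T-≡; T-irrelevant)
open import Data.Unit using (tt)
open import Data.Empty using (⊥-elim)
open import Data.Vec using (Vec; []; _∷_; lookup; tabulate)
open import Data.Vec.Properties using (tabulate-cong; []=⇒lookup; lookup⇒[]=)
open import Data.Vec.Functional using (tail)
open import Data.Product using (Σ; _×_; _,_; proj₁; proj₂)
open import Function using (_∘_)
open import Function.Bundles using (_⇔_; mk⇔; Equivalence)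
open import Relation.Nullary using (Dec; yes; no; ¬_)
open import Relation.Nullary.Decidable
  using (⌊_⌋; T?; _→-dec_; _×-dec_; isYes≗does; does-⇔; dec-true; dec-false)
open import Relation.Binary.PropositionalEquality

∧-intro : ∀ {x y} → T x → T y → T (x ∧ y)
∧-intro p q = Equivalence.from T-∧ (p , q)

∧-elim : ∀ {x y} → T (x ∧ y) → T x × T y
∧-elim = Equivalence.to T-∧

T-not : ∀ {x} → T (not x) ⇔ (¬ T x)
T-not {true} = mk⇔ (λ ()) (λ ¬tt → ¬tt tt)
T-not {false} = mk⇔ (λ _ ()) (λ _ → tt)

quant-irrelevant : ∀ {q q' : Quant} (e e' : q ≡ q') → e ≡ e'
quant-irrelevant refl refl = refl

∀≢∃ : ¬ (∀q ≡ ∃q)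
∀≢∃ ()

⌊⌋-true : ∀ {A : Set} (a? : Dec A) → A → ⌊ a? ⌋ ≡ true
⌊⌋-true a? a = trans (isYes≗does a?) (dec-true a? a)

⌊⌋-false : ∀ {A : Set} (a? : Dec A) → ¬ A → ⌊ a? ⌋ ≡ false
⌊⌋-false a? ¬a = trans (isYes≗does a?) (dec-false a? ¬a)

⌊⌋-⇔ : ∀ {A B : Set} → A ⇔ B → (a? : Dec A) (b? : Dec B) → ⌊ a? ⌋ ≡ ⌊ b? ⌋
⌊⌋-⇔ A⇔B a? b? = trans (isYes≗does a?) (trans (does-⇔ A⇔B a? b?) (sym (isYes≗does b?)))

Abefore-suc : ∀ {m} (Q : Fin (suc m) → Quant) (j : Fin m) →
  Abefore Q (suc j) ≡ isForall (Q zero) ∷ Abefore (tail Q) j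
Abefore-suc {m} Q j =
  cong₂ _∷_ (cong (_∧ isForall (Q zero)) (⌊⌋-true (zero {n = m} <? suc j) (s≤s z≤n)))
            (tabulate-cong λ k → cong (_∧ isForall (Q (suc k)))
               (⌊⌋-⇔ (mk⇔ (λ { (s≤s k<j) → k<j }) s≤s) (suc k <? suc j) (k <? j)))

size-allFalse : ∀ {m} (f : Fin m → Bool) → (∀ j → f j ≡ false) → size (tabulate f) ≡ 0
size-allFalse {zero} f h = refl
size-allFalse {suc m} f h rewrite h zero = size-allFalse (f ∘ suc) (h ∘ suc)

Abefore-zero : ∀ {m} (Q : Fin (suc m) → Quant) → size (Abefore Q zero) ≡ 0
Abefore-zero {m} Q =
  size-allFalse _ λ k → cong (_∧ isForall (Q k)) (⌊⌋-false (k <? zero {n = m}) λ ())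

module _ {d : ℕ} where

  _∋_ : Subset d → Fin d → Set
  S ∋ v = T (lookup S v)

  Pred : ℕ → Set₁
  Pred m = Vec (Fin d) m → Set

  -- The notions of Defs for a prefix Q, domains D and an arbitrary winning
  -- condition P; for P = Sol φ they are literally Strategy, Sce, Winning, Out.
  GStrategy : ∀ {m} → (Fin m → Quant) → (Fin m → Subset d) → Set
  GStrategy {m} Q D = (i : Fin m) → Q i ≡ ∃q →
    (u : VTuple d (Abefore Q i)) → T (inDomV (Abefore Q i) D u) → Σ (Fin d) (D i ∋_)

  GScenario : ∀ {m} (Q : Fin m → Quant) (D : Fin m → Subset d) → GStrategy Q D → Pred m
  GScenario {m} Q D s t = Σ (T (inDom D t)) λ p → (i : Fin m) (e : Q i ≡ ∃q) →
    lookup t i ≡ proj₁ (s i e (restrict (Abefore Q i) t) (restrict-inDom (Abefore Q i) D t p))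

  GWinning : ∀ {m} (Q : Fin m → Quant) (D : Fin m → Subset d) → Pred m → GStrategy Q D → Set
  GWinning Q D P s = ∀ t → GScenario Q D s t → P t

  GOutcome : ∀ {m} (Q : Fin m → Quant) (D : Fin m → Subset d) → Pred m → Pred m
  GOutcome Q D P t = Σ (GStrategy Q D) λ s → GWinning Q D P s × GScenario Q D s t

  AgreeBefore : ∀ {m} → Fin m → Vec (Fin d) m → Vec (Fin d) m → Set
  AgreeBefore {m} i t t' = (j : Fin m) → j < i → lookup t j ≡ lookup t' j

  GShallowFixable : ∀ {m} (Q : Fin m → Quant) (D : Fin m → Subset d) → Pred m → Fin m → Fin d → Set
  GShallowFixable {m} Q D P i a = (t : Vec (Fin d) m) → GOutcome Q D P t →
    Σ (Vec (Fin d) m) λ t' → GOutcome Q D P t' × (AgreeBefore i t t' × lookup t' i ≡ a)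

  move-irrelevant : ∀ {m} {Q : Fin m → Quant} {D : Fin m → Subset d} (s : GStrategy Q D)
    (i : Fin m) (e e' : Q i ≡ ∃q) {u u' : VTuple d (Abefore Q i)} → u ≡ u' →
    (p : T (inDomV (Abefore Q i) D u)) (p' : T (inDomV (Abefore Q i) D u')) →
    proj₁ (s i e u p) ≡ proj₁ (s i e' u' p')
  move-irrelevant s i e e' refl p p'
    rewrite quant-irrelevant e e' | T-irrelevant p p' = refl

  tuple-size0-unique : ∀ {k} → k ≡ 0 → (u u' : Vec (Fin d) k) → u ≡ u'
  tuple-size0-unique refl [] [] = refl

  inDomV-size0 : ∀ {m} (V : Subset m) (D : Fin m → Subset d) (u : VTuple d V) →
    size V ≡ 0 → T (inDomV V D u)
  inDomV-size0 [] D [] _ = tt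
  inDomV-size0 (true ∷ V) D u ()
  inDomV-size0 (false ∷ V) D u h = inDomV-size0 V (tail D) u h

  -- Transporting a tuple along an equality of variable sets; this is how
  -- A_{j+1} of the full prefix is matched with A_j of the shifted one.
  retag : ∀ {m} {V W : Subset m} → V ≡ W → VTuple d V → VTuple d W
  retag refl u = u

  retag-inDom : ∀ {m} {V W : Subset m} (eq : V ≡ W) (D : Fin m → Subset d) (u : VTuple d V) →
    T (inDomV V D u) → T (inDomV W D (retag eq u))
  retag-inDom refl D u p = p

  retag-restrict : ∀ {m} {V W : Subset m} (eq : V ≡ W) (t : Vec (Fin d) m) →
    retag eq (restrict V t) ≡ restrict W t
  retag-restrict refl t = refl

  module FirstVariable {m : ℕ} {Q : Fin (suc m) → Quant} {D : Fin (suc m) → Subset d} where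

    split∃ : Q zero ≡ ∃q → ∀ j → Abefore Q (suc j) ≡ false ∷ Abefore (tail Q) j
    split∃ e j = trans (Abefore-suc Q j) (cong (λ b → isForall b ∷ Abefore (tail Q) j) e)

    split∀ : Q zero ≡ ∀q → ∀ j → Abefore Q (suc j) ≡ true ∷ Abefore (tail Q) j
    split∀ e j = trans (Abefore-suc Q j) (cong (λ b → isForall b ∷ Abefore (tail Q) j) e)

    -- An existential x_0 sees no universal values: its move is a constant.
    firstMove : Q zero ≡ ∃q → GStrategy Q D → Σ (Fin d) (D zero ∋_)
    firstMove e s = s zero e u₀ (inDomV-size0 (Abefore Q zero) D u₀ (Abefore-zero Q))
      where
      u₀ : VTuple d (Abefore Q zero)
      u₀ = subst (Vec (Fin d)) (sym (Abefore-zero Q)) []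

    firstMove-unique : (e e' : Q zero ≡ ∃q) (s : GStrategy Q D) (u : VTuple d (Abefore Q zero))
      (p : T (inDomV (Abefore Q zero) D u)) → proj₁ (s zero e' u p) ≡ proj₁ (firstMove e s)
    firstMove-unique e e' s u p = move-irrelevant s zero e' e (tuple-size0-unique (Abefore-zero Q) _ _) p _

    restrict∃ : Q zero ≡ ∃q → GStrategy Q D → GStrategy (tail Q) (tail D)
    restrict∃ e s j e' u p = s (suc j) e' (retag (sym (split∃ e j)) u) (retag-inDom (sym (split∃ e j)) D u p)

    restrict∀ : Q zero ≡ ∀q → (w : Fin d) → D zero ∋ w → GStrategy Q D → GStrategy (tail Q) (tail D)
    restrict∀ e w wp s j e' u p =
      s (suc j) e' (retag (sym (split∀ e j)) (w ∷ u)) (retag-inDom (sym (split∀ e j)) D (w ∷ u) (∧-intro wp p))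

    extend∃ : Q zero ≡ ∃q → (v : Fin d) → D zero ∋ v → GStrategy (tail Q) (tail D) → GStrategy Q D
    extend∃ e v vp s zero _ _ _ = v , vp
    extend∃ e v vp s (suc j) e' u p = s j e' (retag (split∃ e j) u) (retag-inDom (split∃ e j) D u p)

    Family : Set
    Family = (w : Fin d) → D zero ∋ w → GStrategy (tail Q) (tail D)

    respond : Family → ∀ j → tail Q j ≡ ∃q → (u : VTuple d (true ∷ Abefore (tail Q) j)) →
      T (inDomV (true ∷ Abefore (tail Q) j) D u) → Σ (Fin d) (tail D j ∋_)
    respond f j e' (w ∷ u) p = f w (proj₁ (∧-elim p)) j e' u (proj₂ (∧-elim p))

    respond-cong : (f : Family) (j : Fin m) (e' : tail Q j ≡ ∃q) {w : Fin d} {u' : VTuple d (Abefore (tail Q) j)}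
      {u : VTuple d (true ∷ Abefore (tail Q) j)} → u ≡ w ∷ u' → (p : T (inDomV (true ∷ Abefore (tail Q) j) D u))
      (wp : D zero ∋ w) (p' : T (inDomV (Abefore (tail Q) j) (tail D) u')) →
      proj₁ (respond f j e' u p) ≡ proj₁ (f w wp j e' u' p')
    respond-cong f j e' {w} {u'} refl p wp p' =
      cong₂ (λ x y → proj₁ (f w x j e' u' y)) (T-irrelevant _ wp) (T-irrelevant _ p')

    extend∀ : Q zero ≡ ∀q → Family → GStrategy Q D
    extend∀ e f zero e' = ⊥-elim (∀≢∃ (trans (sym e) e'))
    extend∀ e f (suc j) e' u p = respond f j e' (retag (split∀ e j) u) (retag-inDom (split∀ e j) D u p)

    scenario-restrict∃⇒ : (e : Q zero ≡ ∃q) (s : GStrategy Q D) {w : Fin d} {t : Vec (Fin d) m} →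
      GScenario Q D s (w ∷ t) → GScenario (tail Q) (tail D) (restrict∃ e s) t
    scenario-restrict∃⇒ e s {w} {t} (p , follows) = proj₂ (∧-elim p) , λ j e' →
      trans (follows (suc j) e')
            (move-irrelevant s (suc j) e' e' (sym (retag-restrict (sym (split∃ e j)) (w ∷ t))) _ _)

    scenario-restrict∃⇐ : (e : Q zero ≡ ∃q) (s : GStrategy Q D) {w : Fin d} {t : Vec (Fin d) m} →
      w ≡ proj₁ (firstMove e s) → GScenario (tail Q) (tail D) (restrict∃ e s) t → GScenario Q D s (w ∷ t)
    scenario-restrict∃⇐ e s {t = t} refl (p , follows) = ∧-intro (proj₂ (firstMove e s)) p , λ
      { zero e' → sym (firstMove-unique e e' s _ _)
      ; (suc j) e' → trans (follows j e')
          (move-irrelevant s (suc j) e' e' (retag-restrict (sym (split∃ e j)) (_ ∷ t)) _ _) }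

    scenario-restrict∀⇒ : (e : Q zero ≡ ∀q) (s : GStrategy Q D) {w : Fin d} {t : Vec (Fin d) m}
      (wp : D zero ∋ w) → GScenario Q D s (w ∷ t) → GScenario (tail Q) (tail D) (restrict∀ e w wp s) t
    scenario-restrict∀⇒ e s {w} {t} wp (p , follows) = proj₂ (∧-elim p) , λ j e' →
      trans (follows (suc j) e')
            (move-irrelevant s (suc j) e' e' (sym (retag-restrict (sym (split∀ e j)) (w ∷ t))) _ _)

    scenario-restrict∀⇐ : (e : Q zero ≡ ∀q) (s : GStrategy Q D) {w : Fin d} {t : Vec (Fin d) m}
      (wp : D zero ∋ w) → GScenario (tail Q) (tail D) (restrict∀ e w wp s) t → GScenario Q D s (w ∷ t)
    scenario-restrict∀⇐ e s {w} {t} wp (p , follows) = ∧-intro wp p , λ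
      { zero e' → ⊥-elim (∀≢∃ (trans (sym e) e'))
      ; (suc j) e' → trans (follows j e')
          (move-irrelevant s (suc j) e' e' (retag-restrict (sym (split∀ e j)) (w ∷ t)) _ _) }

    scenario-extend∃⇒ : (e : Q zero ≡ ∃q) (v : Fin d) (vp : D zero ∋ v) (s : GStrategy (tail Q) (tail D))
      {w : Fin d} {t : Vec (Fin d) m} →
      GScenario Q D (extend∃ e v vp s) (w ∷ t) → w ≡ v × GScenario (tail Q) (tail D) s t
    scenario-extend∃⇒ e v vp s {w} {t} (p , follows) = follows zero e , proj₂ (∧-elim p) , λ j e' →
      trans (follows (suc j) e') (move-irrelevant s j e' e' (retag-restrict (split∃ e j) (w ∷ t)) _ _)

    scenario-extend∃⇐ : (e : Q zero ≡ ∃q) (v : Fin d) (vp : D zero ∋ v) (s : GStrategy (tail Q) (tail D))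
      {t : Vec (Fin d) m} → GScenario (tail Q) (tail D) s t → GScenario Q D (extend∃ e v vp s) (v ∷ t)
    scenario-extend∃⇐ e v vp s {t} (p , follows) = ∧-intro vp p , λ
      { zero e' → refl
      ; (suc j) e' → trans (follows j e')
          (move-irrelevant s j e' e' (sym (retag-restrict (split∃ e j) (v ∷ t))) _ _) }

    scenario-extend∀⇒ : (e : Q zero ≡ ∀q) (f : Family) {w : Fin d} {t : Vec (Fin d) m} →
      GScenario Q D (extend∀ e f) (w ∷ t) → Σ (D zero ∋ w) λ wp → GScenario (tail Q) (tail D) (f w wp) t
    scenario-extend∀⇒ e f {w} {t} (p , follows) = proj₁ (∧-elim p) , proj₂ (∧-elim p) , λ j e' →
      trans (follows (suc j) e') (respond-cong f j e' (retag-restrict (split∀ e j) (w ∷ t)) _ _ _)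

    scenario-extend∀⇐ : (e : Q zero ≡ ∀q) (f : Family) {w : Fin d} {t : Vec (Fin d) m}
      (wp : D zero ∋ w) → GScenario (tail Q) (tail D) (f w wp) t → GScenario Q D (extend∀ e f) (w ∷ t)
    scenario-extend∀⇐ e f {w} {t} wp (p , follows) = ∧-intro wp p , λ
      { zero e' → ⊥-elim (∀≢∃ (trans (sym e) e'))
      ; (suc j) e' → trans (follows j e')
          (sym (respond-cong f j e' (retag-restrict (split∀ e j) (w ∷ t)) _ wp _)) }

    winning-restrict∃ : (e : Q zero ≡ ∃q) (s : GStrategy Q D) {P : Pred (suc m)} {w : Fin d} →
      w ≡ proj₁ (firstMove e s) → GWinning Q D P s → GWinning (tail Q) (tail D) (P ∘ (w ∷_)) (restrict∃ e s)
    winning-restrict∃ e s hw win t sc = win (_ ∷ t) (scenario-restrict∃⇐ e s hw sc)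

    winning-restrict∀ : (e : Q zero ≡ ∀q) (s : GStrategy Q D) {P : Pred (suc m)} {w : Fin d}
      (wp : D zero ∋ w) → GWinning Q D P s → GWinning (tail Q) (tail D) (P ∘ (w ∷_)) (restrict∀ e w wp s)
    winning-restrict∀ e s wp win t sc = win (_ ∷ t) (scenario-restrict∀⇐ e s wp sc)

    winning-extend∃ : (e : Q zero ≡ ∃q) (v : Fin d) (vp : D zero ∋ v) (s : GStrategy (tail Q) (tail D))
      {P : Pred (suc m)} → GWinning (tail Q) (tail D) (P ∘ (v ∷_)) s → GWinning Q D P (extend∃ e v vp s)
    winning-extend∃ e v vp s win (w ∷ t) sc with scenario-extend∃⇒ e v vp s sc
    ... | refl , sc' = win t sc'

    winning-extend∀ : (e : Q zero ≡ ∀q) (f : Family) {P : Pred (suc m)} →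
      (∀ w (wp : D zero ∋ w) → GWinning (tail Q) (tail D) (P ∘ (w ∷_)) (f w wp)) →
      GWinning Q D P (extend∀ e f)
    winning-extend∀ e f wins (w ∷ t) sc with scenario-extend∀⇒ e f sc
    ... | wp , sc' = wins w wp t sc'

  open FirstVariable

  -- eval (suc m) Q D P, with its first quantifier q made explicit; the
  -- case analyses below split on q while keeping Q zero ≡ q as evidence.
  evalFrom : ∀ {m} → Quant → (Fin (suc m) → Quant) → (Fin (suc m) → Subset d) → Pred (suc m) → Set
  evalFrom {m} q Q D P = quant q (D zero) (λ v → eval m (tail Q) (tail D) (P ∘ (v ∷_)))

  true⇒winning : ∀ m (Q : Fin m → Quant) (D : Fin m → Subset d) (P : Pred m) →
    eval m Q D P → Σ (GStrategy Q D) (GWinning Q D P)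
  true⇒winning zero Q D P ev = (λ ()) , λ { [] _ → ev }
  true⇒winning (suc m) Q D P ev = byFirst (Q zero) refl ev
    where
    byFirst : ∀ q → Q zero ≡ q → evalFrom q Q D P → Σ (GStrategy Q D) (GWinning Q D P)
    byFirst ∃q e (v , vp , ev') =
      let (s , win) = true⇒winning m (tail Q) (tail D) (P ∘ (v ∷_)) ev'
      in extend∃ e v vp s , winning-extend∃ e v vp s win
    byFirst ∀q e ev' = extend∀ e (λ w wp → proj₁ (subgame w wp)) ,
                       winning-extend∀ e _ (λ w wp → proj₂ (subgame w wp))
      where
      subgame : ∀ w → D zero ∋ w → Σ (GStrategy (tail Q) (tail D)) (GWinning (tail Q) (tail D) (P ∘ (w ∷_)))
      subgame w wp = true⇒winning m (tail Q) (tail D) (P ∘ (w ∷_)) (ev' w wp)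

  winning⇒true : ∀ m (Q : Fin m → Quant) (D : Fin m → Subset d) (P : Pred m) (s : GStrategy Q D) →
    GWinning Q D P s → eval m Q D P
  winning⇒true zero Q D P s win = win [] (tt , λ ())
  winning⇒true (suc m) Q D P s win = byFirst (Q zero) refl
    where
    byFirst : ∀ q → Q zero ≡ q → evalFrom q Q D P
    byFirst ∃q e = proj₁ (firstMove e s) , proj₂ (firstMove e s) ,
      winning⇒true m (tail Q) (tail D) _ (restrict∃ e s) (winning-restrict∃ e s refl win)
    byFirst ∀q e w wp =
      winning⇒true m (tail Q) (tail D) _ (restrict∀ e w wp s) (winning-restrict∀ e s wp win)

  Outcome : ∀ m (Q : Fin m → Quant) (D : Fin m → Subset d) → Pred m → Pred m
  Outcome zero Q D P [] = P []
  Outcome (suc m) Q D P (v ∷ t) =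
    D zero ∋ v × Outcome m (tail Q) (tail D) (P ∘ (v ∷_)) t ×
    (Q zero ≡ ∀q → ∀ w → D zero ∋ w → eval m (tail Q) (tail D) (P ∘ (w ∷_)))

  -- Outcome characterisation: restrict the strategy after the first value ...
  gOutcome⇒outcome : ∀ m (Q : Fin m → Quant) (D : Fin m → Subset d) (P : Pred m) (t : Vec (Fin d) m) →
    GOutcome Q D P t → Outcome m Q D P t
  gOutcome⇒outcome zero Q D P [] (s , win , sc) = win [] sc
  gOutcome⇒outcome (suc m) Q D P (w ∷ t) (s , win , sc) = byFirst (Q zero) refl
    where
    wp : D zero ∋ w
    wp = proj₁ (∧-elim (proj₁ sc))
    byFirst : ∀ q → Q zero ≡ q → Outcome (suc m) Q D P (w ∷ t)
    byFirst ∃q e = wp , gOutcome⇒outcome m (tail Q) (tail D) _ t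
                          (restrict∃ e s , winning-restrict∃ e s w≡first win , scenario-restrict∃⇒ e s sc) ,
                   λ e' → ⊥-elim (∀≢∃ (trans (sym e') e))
      where
      w≡first : w ≡ proj₁ (firstMove e s)
      w≡first = trans (proj₂ sc zero e) (firstMove-unique e e s _ _)
    byFirst ∀q e = wp , gOutcome⇒outcome m (tail Q) (tail D) _ t
                          (restrict∀ e w wp s , winning-restrict∀ e s wp win , scenario-restrict∀⇒ e s wp sc) ,
                   λ _ w' wp' → winning⇒true m (tail Q) (tail D) _ (restrict∀ e w' wp' s) (winning-restrict∀ e s wp' win)

  -- ... and conversely extend strategies for the subgames by a first move.
  outcome⇒gOutcome : ∀ m (Q : Fin m → Quant) (D : Fin m → Subset d) (P : Pred m) (t : Vec (Fin d) m) →
    Outcome m Q D P t → GOutcome Q D P t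
  outcome⇒gOutcome zero Q D P [] o = (λ ()) , (λ { [] _ → o }) , tt , λ ()
  outcome⇒gOutcome (suc m) Q D P (v ∷ t) (vp , o , others) = byFirst (Q zero) refl
    where
    rest : GOutcome (tail Q) (tail D) (P ∘ (v ∷_)) t
    rest = outcome⇒gOutcome m (tail Q) (tail D) (P ∘ (v ∷_)) t o
    s : GStrategy (tail Q) (tail D)
    s = proj₁ rest
    byFirst : ∀ q → Q zero ≡ q → GOutcome Q D P (v ∷ t)
    byFirst ∃q e = extend∃ e v vp s , winning-extend∃ e v vp s (proj₁ (proj₂ rest)) ,
                   scenario-extend∃⇐ e v vp s (proj₂ (proj₂ rest))
    byFirst ∀q e = extend∀ e strategyAfter , winning-extend∀ e strategyAfter (λ w wp → proj₂ (choice w (w ≟ v) wp)) ,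
                   scenario-extend∀⇐ e strategyAfter vp
                     (subst (λ s' → GScenario (tail Q) (tail D) s' t) (sym (choice-self (v ≟ v))) (proj₂ (proj₂ rest)))
      where
      choice : ∀ w → Dec (w ≡ v) → D zero ∋ w →
        Σ (GStrategy (tail Q) (tail D)) (GWinning (tail Q) (tail D) (P ∘ (w ∷_)))
      choice w (yes refl) _ = s , proj₁ (proj₂ rest)
      choice w (no _) wp = true⇒winning m (tail Q) (tail D) _ (others e w wp)
      strategyAfter : (w : Fin d) → D zero ∋ w → GStrategy (tail Q) (tail D)
      strategyAfter w wp = proj₁ (choice w (w ≟ v) wp)
      choice-self : (dec : Dec (v ≡ v)) → proj₁ (choice v dec vp) ≡ s
      choice-self (yes refl) = refl
      choice-self (no v≢v) = ⊥-elim (v≢v refl)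

  outcome⇒true : ∀ m (Q : Fin m → Quant) (D : Fin m → Subset d) (P : Pred m) (t : Vec (Fin d) m) →
    Outcome m Q D P t → eval m Q D P
  outcome⇒true zero Q D P [] o = o
  outcome⇒true (suc m) Q D P (v ∷ t) (vp , o , others) = byFirst (Q zero) refl
    where
    byFirst : ∀ q → Q zero ≡ q → evalFrom q Q D P
    byFirst ∃q e = v , vp , outcome⇒true m (tail Q) (tail D) _ t o
    byFirst ∀q e = others e

  true⇒outcome : ∀ m (Q : Fin m → Quant) (D : Fin m → Subset d) (P : Pred m) →
    (∀ j → Σ (Fin d) (D j ∋_)) → eval m Q D P → Σ (Vec (Fin d) m) (Outcome m Q D P)
  true⇒outcome zero Q D P _ ev = [] , ev
  true⇒outcome (suc m) Q D P inhabited ev = byFirst (Q zero) refl ev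
    where
    rest : ∀ v → eval m (tail Q) (tail D) (P ∘ (v ∷_)) →
      Σ (Vec (Fin d) m) (Outcome m (tail Q) (tail D) (P ∘ (v ∷_)))
    rest v = true⇒outcome m (tail Q) (tail D) (P ∘ (v ∷_)) (inhabited ∘ suc)
    byFirst : ∀ q → Q zero ≡ q → evalFrom q Q D P → Σ (Vec (Fin d) (suc m)) (Outcome (suc m) Q D P)
    byFirst ∃q e (v , vp , ev') =
      v ∷ proj₁ (rest v ev') , vp , proj₂ (rest v ev') , λ e' → ⊥-elim (∀≢∃ (trans (sym e') e))
    byFirst ∀q e ev' =
      let (w , wp) = inhabited zero
      in w ∷ proj₁ (rest w (ev' w wp)) , wp , proj₂ (rest w (ev' w wp)) , λ _ → ev'

  -- Relaxes q Dx Dy: replacing the domain Dx of a q-quantifier by Dy cannot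
  -- falsify it (universal domains may shrink, existential ones may grow).
  Relaxes : Quant → Subset d → Subset d → Set
  Relaxes ∀q Dx Dy = ∀ v → Dy ∋ v → Dx ∋ v
  Relaxes ∃q Dx Dy = ∀ v → Dx ∋ v → Dy ∋ v

  relaxes-≡ : ∀ q {Dx Dy : Subset d} → Dx ≡ Dy → Relaxes q Dx Dy
  relaxes-≡ ∀q refl v p = p
  relaxes-≡ ∃q refl v p = p

  quant-mono : ∀ q {Dx Dy : Subset d} {A B : Fin d → Set} → Relaxes q Dx Dy →
    (∀ v → Dy ∋ v → A v → B v) → quant q Dx A → quant q Dy B
  quant-mono ∀q r h f v vp = h v vp (f v (r v vp))
  quant-mono ∃q r h (v , vp , a) = v , r v vp , h v (r v vp) a

  eval-mono : ∀ m (Q : Fin m → Quant) (D D' : Fin m → Subset d) (P P' : Pred m) →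
    (∀ j → Relaxes (Q j) (D j) (D' j)) → (∀ t → T (inDom D' t) → P t → P' t) →
    eval m Q D P → eval m Q D' P'
  eval-mono zero Q D D' P P' r h ev = h [] tt ev
  eval-mono (suc m) Q D D' P P' r h ev = quant-mono (Q zero) (r zero)
    (λ v vp → eval-mono m (tail Q) (tail D) (tail D') _ _ (r ∘ suc) (λ t tp → h (v ∷ t) (∧-intro vp tp))) ev

  eval-emptyDomain : ∀ m (Q : Fin m → Quant) (D : Fin m → Subset d) (P P' : Pred m) (j : Fin m) →
    (∀ v → ¬ (D j ∋ v)) → eval m Q D P → eval m Q D P'
  eval-emptyDomain (suc m) Q D P P' zero empty ev = byFirst (Q zero) ev
    where
    byFirst : ∀ q {A B : Fin d → Set} → quant q (D zero) A → quant q (D zero) B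
    byFirst ∀q f v vp = ⊥-elim (empty v vp)
    byFirst ∃q (v , vp , _) = ⊥-elim (empty v vp)
  eval-emptyDomain (suc m) Q D P P' (suc j) empty ev = quant-mono (Q zero) (relaxes-≡ (Q zero) refl)
    (λ v _ → eval-emptyDomain m (tail Q) (tail D) _ _ j empty) ev

  eval-dual-disjoint : ∀ m (Q : Fin m → Quant) (D : Fin m → Subset d) (P P' : Pred m) →
    (∀ t → P t → ¬ P' t) → eval m (dual ∘ Q) D P → ¬ eval m Q D P'
  eval-dual-disjoint zero Q D P P' disjoint ev ev' = disjoint [] ev ev'
  eval-dual-disjoint (suc m) Q D P P' disjoint ev ev' = byFirst (Q zero) ev ev'
    where
    rest : ∀ v → eval m (tail (dual ∘ Q)) (tail D) (P ∘ (v ∷_)) → ¬ eval m (tail Q) (tail D) (P' ∘ (v ∷_))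
    rest v = eval-dual-disjoint m (tail Q) (tail D) _ _ (disjoint ∘ (v ∷_))
    byFirst : ∀ q → evalFrom (dual q) (dual ∘ Q) D P → ¬ evalFrom q Q D P'
    byFirst ∀q (v , vp , e) f = rest v e (f v vp)
    byFirst ∃q f (v , vp , e') = rest v (f v vp) e'

  eval-dec : ∀ m (Q : Fin m → Quant) (D : Fin m → Subset d) (P : Pred m) →
    (∀ t → Dec (P t)) → Dec (eval m Q D P)
  eval-dec zero Q D P P? = P? []
  eval-dec (suc m) Q D P P? = byFirst (Q zero)
    where
    rest? : ∀ v → Dec (eval m (tail Q) (tail D) (P ∘ (v ∷_)))
    rest? v = eval-dec m (tail Q) (tail D) _ (P? ∘ (v ∷_))
    byFirst : ∀ q → Dec (evalFrom q Q D P)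
    byFirst ∀q = all? (λ v → T? (lookup (D zero) v) →-dec rest? v)
    byFirst ∃q = any? (λ v → T? (lookup (D zero) v) ×-dec rest? v)

  eval-negate : ∀ m (Q : Fin m → Quant) (D : Fin m → Subset d) (P : Pred m) →
    (∀ t → Dec (P t)) → ¬ eval m Q D P → eval m (dual ∘ Q) D (¬_ ∘ P)
  eval-negate zero Q D P P? refuted = refuted
  eval-negate (suc m) Q D P P? refuted = byFirst (Q zero) refuted
    where
    rest : ∀ v → ¬ eval m (tail Q) (tail D) (P ∘ (v ∷_)) → eval m (tail (dual ∘ Q)) (tail D) (¬_ ∘ P ∘ (v ∷_))
    rest v = eval-negate m (tail Q) (tail D) _ (P? ∘ (v ∷_))
    byFirst : ∀ q → ¬ evalFrom q Q D P → evalFrom (dual q) (dual ∘ Q) D (¬_ ∘ P)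
    byFirst ∃q refuted v vp = rest v λ ev → refuted (v , vp , ev)
    byFirst ∀q refuted
      with (v , counter) ← ¬∀⟶∃¬ d _ (λ v → T? (lookup (D zero) v) →-dec eval-dec m (tail Q) (tail D) _ (P? ∘ (v ∷_))) refuted
      with T? (lookup (D zero) v)
    ... | yes vp = v , vp , rest v λ ev → counter λ _ → ev
    ... | no ¬vp = ⊥-elim (counter λ vp → ⊥-elim (¬vp vp))

  Fixable : ∀ m (Q : Fin m → Quant) (D : Fin m → Subset d) → Pred m → Fin m → Fin d → Set
  Fixable m Q D P i a = (t : Vec (Fin d) m) → Outcome m Q D P t →
    Σ (Vec (Fin d) m) λ t' → Outcome m Q D P t' × (AgreeBefore i t t' × lookup t' i ≡ a)

  shallowFixable⇒fixable : ∀ m (Q : Fin m → Quant) (D : Fin m → Subset d) (P : Pred m) i a →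
    GShallowFixable Q D P i a → Fixable m Q D P i a
  shallowFixable⇒fixable m Q D P i a sf t o =
    let (t' , o' , agree , t'ᵢ≡a) = sf t (outcome⇒gOutcome m Q D P t o)
    in t' , gOutcome⇒outcome m Q D P t' o' , agree , t'ᵢ≡a

  fixable-tail : ∀ m (Q : Fin (suc m) → Quant) (D : Fin (suc m) → Subset d) (P : Pred (suc m)) i a v →
    Fixable (suc m) Q D P (suc i) a → D zero ∋ v →
    (Q zero ≡ ∀q → ∀ w → D zero ∋ w → eval m (tail Q) (tail D) (P ∘ (w ∷_))) →
    Fixable m (tail Q) (tail D) (P ∘ (v ∷_)) i a
  fixable-tail m Q D P i a v fx vp others t o
    with w ∷ t' , (_ , o' , _) , agree , t'ᵢ≡a ← fx (v ∷ t) (vp , o , others)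
    with refl ← agree zero (s≤s z≤n)
    = t' , o' , (λ j j<i → agree (suc j) (s≤s j<i)) , t'ᵢ≡a

  fixable-first : ∀ m (Q : Fin (suc m) → Quant) (D : Fin (suc m) → Subset d) (P : Pred (suc m)) a →
    Q zero ≡ ∃q → Fixable (suc m) Q D P zero a → eval (suc m) Q D P → eval m (tail Q) (tail D) (P ∘ (a ∷_))
  fixable-first m Q D P a e fx ev
    with v , vp , evᵥ ← subst (λ q → evalFrom q Q D P) e ev
    with all? (λ j → any? (λ w → T? (lookup (D (suc j)) w)))
  ... | yes inhabited =
    let (t , o) = true⇒outcome m (tail Q) (tail D) _ inhabited evᵥ
        (t' , o' , _ , t'₀≡a) = fx (v ∷ t) (vp , o , λ e' → ⊥-elim (∀≢∃ (trans (sym e') e)))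
    in playsA t' o' t'₀≡a
    where
    playsA : ∀ t' → Outcome (suc m) Q D P t' → lookup t' zero ≡ a → eval m (tail Q) (tail D) (P ∘ (a ∷_))
    playsA (w ∷ t') (_ , o' , _) refl = outcome⇒true m (tail Q) (tail D) _ t' o'
  ... | no ¬inhabited =
    let (j , empty) = ¬∀⟶∃¬ m _ (λ j → any? (λ w → T? (lookup (D (suc j)) w))) ¬inhabited
    in eval-emptyDomain m (tail Q) (tail D) _ _ j (λ w wp → empty (w , wp)) evᵥ

  dual-fixable-exclusion : ∀ m (Q : Fin m → Quant) (D D' : Fin m → Subset d) (Pψ Pφ : Pred m) i a →
    Q i ≡ ∀q → D' i ∋ a → (∀ j → j ≢ i → D' j ≡ D j) → (∀ t → Pψ t → ¬ Pφ t) →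
    Fixable m (dual ∘ Q) D Pψ i a → eval m (dual ∘ Q) D Pψ → ¬ eval m Q D' Pφ
  dual-fixable-exclusion (suc m) Q D D' Pψ Pφ zero a hQ ha hD disjoint fx evψ evφ =
    eval-dual-disjoint m (tail Q) (tail D) _ _ (disjoint ∘ (a ∷_)) ψₐ φₐ
    where
    ψₐ : eval m (tail (dual ∘ Q)) (tail D) (Pψ ∘ (a ∷_))
    ψₐ = fixable-first m (dual ∘ Q) D Pψ a (cong dual hQ) fx evψ
    φₐ : eval m (tail Q) (tail D) (Pφ ∘ (a ∷_))
    φₐ = eval-mono m (tail Q) (tail D') (tail D) _ _ (λ j → relaxes-≡ (Q (suc j)) (hD (suc j) λ ()))
           (λ _ _ φt → φt) (subst (λ q → evalFrom q Q D' Pφ) hQ evφ a ha)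
  dual-fixable-exclusion (suc m) Q D D' Pψ Pφ (suc i) a hQ ha hD disjoint fx evψ evφ =
    byFirst (Q zero) refl evψ evφ
    where
    D'₀≡D₀ : D' zero ≡ D zero
    D'₀≡D₀ = hD zero λ ()
    afterFirst : ∀ v → D zero ∋ v →
      (dual (Q zero) ≡ ∀q → ∀ w → D zero ∋ w → eval m (tail (dual ∘ Q)) (tail D) (Pψ ∘ (w ∷_))) →
      eval m (tail (dual ∘ Q)) (tail D) (Pψ ∘ (v ∷_)) → ¬ eval m (tail Q) (tail D') (Pφ ∘ (v ∷_))
    afterFirst v vp others = dual-fixable-exclusion m (tail Q) (tail D) (tail D') _ _ i a hQ ha
      (λ j j≢i → hD (suc j) (j≢i ∘ suc-injective)) (disjoint ∘ (v ∷_))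
      (fixable-tail m (dual ∘ Q) D Pψ i a v fx vp others)
    byFirst : ∀ q → Q zero ≡ q → evalFrom (dual q) (dual ∘ Q) D Pψ → ¬ evalFrom q Q D' Pφ
    byFirst ∀q e (v , vp , ψᵥ) φ =
      afterFirst v vp (λ e' → ⊥-elim (∀≢∃ (trans (sym e') (cong dual e)))) ψᵥ (φ v (subst (_∋ v) (sym D'₀≡D₀) vp))
    byFirst ∃q e ψ (v , vp' , φᵥ) = afterFirst v vp (λ _ → ψ) (ψ v vp) φᵥ
      where
      vp : D zero ∋ v
      vp = subst (_∋ v) D'₀≡D₀ vp'

fullToVec-restrict : ∀ {d} n (t : Vec (Fin d) n) → fullToVec n (restrict (⊤ {n}) t) ≡ t
fullToVec-restrict zero [] = refl
fullToVec-restrict (suc n) (x ∷ t) = cong (x ∷_) (fullToVec-restrict n t)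

∈⇒∋ : ∀ {d} {S : Subset d} {v : Fin d} → v ∈ S → S ∋ v
∈⇒∋ v∈S = Equivalence.from T-≡ ([]=⇒lookup v∈S)

∋⇒∈ : ∀ {d} {S : Subset d} {v : Fin d} → S ∋ v → v ∈ S
∋⇒∈ {S = S} {v} S∋v = lookup⇒[]= v S (Equivalence.to T-≡ S∋v)

module _ {n d : ℕ} (φ : QCSP n d) where

  negation-excludes : ∀ t → Sol (negQCSP φ) t → ¬ Sol φ t
  negation-excludes t s rewrite fullToVec-restrict n t =
    Equivalence.to T-not (proj₂ (∧-elim {inDom (D φ) t} (proj₁ (∧-elim {inDom (D φ) t ∧ not (satB (C φ) t)} {true} s))))

  negation-includes : ∀ t → T (inDom (D φ) t) → ¬ Sol φ t → Sol (negQCSP φ) t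
  negation-includes t tp ¬s rewrite fullToVec-restrict n t = ∧-intro (∧-intro tp (Equivalence.from T-not ¬s)) tt

  false⇒negation-true : ¬ IsTrue φ → IsTrue (negQCSP φ)
  false⇒negation-true φ-false =
    eval-mono n (dual ∘ Q φ) (D φ) (D φ) _ _ (λ j → relaxes-≡ (dual (Q φ j)) refl) negation-includes
      (eval-negate n (Q φ) (D φ) (Sol φ) (λ t → T? (satB (C φ) t)) φ-false)

module _ {n d : ℕ} (φ : QCSP n d) (i : Fin n) (a : Fin d) where

  fixDomain-other : ∀ j → j ≢ i → D (fixDomain φ i a) j ≡ D φ j
  fixDomain-other j j≢i with j ≟ i
  ... | yes j≡i = ⊥-elim (j≢i j≡i)
  ... | no _ = refl

  fixDomain-admits : D (fixDomain φ i a) i ∋ a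
  fixDomain-admits with i ≟ i
  ... | yes _ = ∈⇒∋ (x∈⁅x⁆ a)
  ... | no i≢i = ⊥-elim (i≢i refl)

  fixDomain-relaxes : Q φ i ≡ ∀q → a ∈ D φ i → ∀ j → Relaxes (Q φ j) (D φ j) (D (fixDomain φ i a) j)
  fixDomain-relaxes hQ ha j with j ≟ i
  ... | no _ = relaxes-≡ (Q φ j) refl
  ... | yes refl rewrite hQ = λ v v∈⁅a⁆ → subst (D φ i ∋_) (sym (x∈⁅y⁆⇒x≡y a (∋⇒∈ v∈⁅a⁆))) (∈⇒∋ ha)

-- Proposition 9.  φ ⇒ φ' because x_i is universal and its domain shrinks;
-- φ' ⇒ φ because otherwise ¬φ would be true, which the core lemma excludes.
proposition9 : ∀ {n d} (φ : QCSP n d) (i : Fin n) (a : Fin d) →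
    Q φ i ≡ ∀q → a ∈ D φ i → DualShallowFixable φ i a →
    (IsTrue φ ⇔ IsTrue (fixDomain φ i a))
proposition9 {n} φ i a hQ ha dsf = mk⇔ fix unfix
  where
  φ' = fixDomain φ i a
  fix : IsTrue φ → IsTrue φ'
  fix = eval-mono n (Q φ) (D φ) (D φ') (Sol φ) (Sol φ) (fixDomain-relaxes φ i a hQ ha) (λ _ _ s → s)
  unfix : IsTrue φ' → IsTrue φ
  unfix φ'-true with eval-dec n (Q φ) (D φ) (Sol φ) (λ t → T? (satB (C φ) t))
  ... | yes φ-true = φ-true
  ... | no φ-false = ⊥-elim (dual-fixable-exclusion n (Q φ) (D φ) (D φ') (Sol (negQCSP φ)) (Sol φ) i a
          hQ (fixDomain-admits φ i a) (fixDomain-other φ i a) (negation-excludes φ)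
          (shallowFixable⇒fixable n (dual ∘ Q φ) (D φ) (Sol (negQCSP φ)) i a dsf)
          (false⇒negation-true φ φ-false) φ'-true)
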